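{- Let $n\geq 2$ and $v\geq 2$ be integers. Then the graph $\Gamma(n,v)$ defined below is strongly $(n,v)$-clique-partitioned, and it has exactly $\frac{n}{2}v(v-1)+\frac{nv(n-1)(v-2)}{2}$ edges; hence the upper bound $\frac{n}{2}v(v-1)+\frac{nv(n-1)(v-2)}{2}$ on the number of edges of a strongly $(n,v)$-clique-partitioned graph is attained.
   Context: The graph $\Gamma(n,v)$ has vertex set $\{(i,j):0\leq i\leq n-1,\ 0\leq j\leq v-1\}$, and $(i,j)$ is adjacent to $(k,\ell)$ if and only if one of the following holds: (1) $i=k$ and $j\neq \ell$; (2) $i<k$ and $\ell-j\not\equiv 0$ and $\ell-j\not\equiv 1 \pmod v$; (3) $i>k$ and $j-\ell\not\equiv 0$ and $j-\ell\not\equiv 1\pmod v$. A $v$-clique is a set of $v$ pairwise adjacent vertices. A graph of order $nv$ is weakly $(n,v)$-clique-partitioned if its vertex set can be decomposed in a unique way into $n$ vertex-disjoint $v$-cliques; it is strongly $(n,v)$-clique-partitioned if moreover the only $v$-cliques in it are the $n$ cliques of that decomposition. -}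

module Defs where

open import Data.Nat as ℕ using (ℕ; _<_; _≤_)
open import Data.Nat.Properties as ℕP using ()
open import Data.Integer as ℤ using (ℤ; +_; _-_)
open import Data.Integer.Divisibility as ℤD using ()
import Data.Nat.Divisibility as ℕD
open import Data.Fin as Fin using (Fin; toℕ)
open import Data.Fin.Properties using (_≟_)
open import Data.Product using (Σ; _×_; _,_)
open import Data.Sum using (_⊎_)
open import Data.List using (List; []; _∷_; length; map; _++_; filter; allFin; cartesianProduct)
open import Data.List.Membership.Propositional using (_∈_; _∉_)
open import Data.List.Relation.Unary.All using (All)
open import Data.List.Relation.Unary.Any using (Any)
open import Data.List.Relation.Unary.AllPairs using (AllPairs)
open import Data.List.Relation.Unary.Unique.Propositional using (Unique)
open import Relation.Binary.PropositionalEquality using (_≡_; _≢_)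
open import Relation.Nullary using (¬_; Dec)
open import Relation.Nullary.Decidable using (_×-dec_; _⊎-dec_; ¬?)
open import Function.Bundles using (_⇔_)

-- Finite vertex sets are represented by
-- duplicate-free lists; two such lists denote the same set when they
-- have the same members.

module GraphNotions {V : Set} (Adj : V → V → Set) where

  SameSet : List V → List V → Set
  SameSet C D = ∀ x → (x ∈ C) ⇔ (x ∈ D)

  IsClique : ℕ → List V → Set
  IsClique k C = Unique C × length C ≡ k × AllPairs Adj C

  Disjoint : List V → List V → Set
  Disjoint C D = ∀ x → x ∈ C → x ∉ D

  IsDecomposition : ℕ → ℕ → List (List V) → Set
  IsDecomposition n v D =
    length D ≡ n × All (IsClique v) D × AllPairs Disjoint D
    × (∀ x → Any (x ∈_) D)

  SameFamily : List (List V) → List (List V) → Set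
  SameFamily D D' = All (λ C → Any (SameSet C) D') D × All (λ C → Any (SameSet C) D) D'

  WeaklyCP : ℕ → ℕ → Set
  WeaklyCP n v = Σ (List (List V)) λ D →
    IsDecomposition n v D × (∀ D' → IsDecomposition n v D' → SameFamily D D')

  StronglyCP : ℕ → ℕ → Set
  StronglyCP n v = Σ (List (List V)) λ D →
    IsDecomposition n v D × (∀ D' → IsDecomposition n v D' → SameFamily D D')
    × (∀ C → IsClique v C → Any (SameSet C) D)

orderedPairs : {A : Set} → List A → List (A × A)
orderedPairs []       = []
orderedPairs (x ∷ xs) = map (x ,_) xs ++ orderedPairs xs

Vertex : ℕ → ℕ → Set
Vertex n v = Fin n × Fin v

CongMod : ℕ → ℤ → ℤ → Set
CongMod v a b = (+ v) ℤD.∣ (a - b)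

congMod? : ∀ v a b → Dec (CongMod v a b)
congMod? v a b = v ℕD.∣? ℤ.∣ a - b ∣

NotDiff01 : ∀ {v} → Fin v → Fin v → Set
NotDiff01 {v} j ℓ =
  ¬ CongMod v ((+ toℕ ℓ) - (+ toℕ j)) (+ 0) × ¬ CongMod v ((+ toℕ ℓ) - (+ toℕ j)) (+ 1)

notDiff01? : ∀ {v} (j ℓ : Fin v) → Dec (NotDiff01 j ℓ)
notDiff01? {v} j ℓ =
  ¬? (congMod? v ((+ toℕ ℓ) - (+ toℕ j)) (+ 0))
  ×-dec ¬? (congMod? v ((+ toℕ ℓ) - (+ toℕ j)) (+ 1))

ΓAdj : ∀ n v → Vertex n v → Vertex n v → Set
ΓAdj n v (i , j) (k , ℓ) =
    (i ≡ k × j ≢ ℓ)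
  ⊎ (toℕ i < toℕ k × NotDiff01 j ℓ)
  ⊎ (toℕ k < toℕ i × NotDiff01 ℓ j)

ΓAdj? : ∀ n v (x y : Vertex n v) → Dec (ΓAdj n v x y)
ΓAdj? n v (i , j) (k , ℓ) =
     ((i ≟ k) ×-dec ¬? (j ≟ ℓ))
  ⊎-dec ((toℕ i ℕ.<? toℕ k) ×-dec notDiff01? j ℓ)
  ⊎-dec ((toℕ k ℕ.<? toℕ i) ×-dec notDiff01? ℓ j)

ΓVertices : ∀ n v → List (Vertex n v)
ΓVertices n v = cartesianProduct (allFin n) (allFin v)

ΓEdgeCount : ℕ → ℕ → ℕ
ΓEdgeCount n v = length (filter (λ p → ΓAdj? n v (Data.Product.proj₁ p) (Data.Product.proj₂ p))
                                (orderedPairs (ΓVertices n v)))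

module Γ (n v : ℕ) = GraphNotions (ΓAdj n v)

-- Adjacent vertices of Γ(n,v) lie in different columns, so a v-clique meets every column exactly
-- once.  Let m be the largest row it meets and (m , j) one of its vertices.  The clique vertex in
-- column j − 1 cannot lie in a row r < m, because (r , j − 1) ~ (m , j) would need
-- j − (j − 1) ≢ 1 (mod v); so it is (m , j − 1).  Going round the cycle, the whole of row m lies in
-- the clique, hence every v-clique is a row, and the rows form the unique decomposition.
-- For the edge count: rows are cliques, and a vertex (r , j) is adjacent to exactly v − 2 vertices
-- of any other row, all but those in column j and in column j + 1 or j − 1 (according to which
-- of the two rows comes first).

module Submission where

open import Defs
open import Data.Bool using (true; false)
open import Data.Nat as ℕ using (ℕ; zero; suc; _≤_; _<_; _*_; _+_; _∸_; s≤s)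
open import Data.Nat.Properties as ℕ
  using (<-irrefl; <-asym; ≤-antisym; ≤-<-trans; ⊔-lub; suc-injective; *-distribˡ-+
        ; ∣m-n∣≤m⊔n; ∣m-n∣≡0⇒m≡n; m≡n⇒∣m-n∣≡0)
open import Data.Nat.Divisibility using (_∣_; >⇒∤; ∣⇒≤; _∣0; ∣-refl)
open import Data.Nat.Combinatorics using (_C_; nC1≡n; nCk+nC[k+1]≡[n+1]C[k+1])
open import Data.Nat.Tactic.RingSolver using (solve-∀)
open import Data.Integer as ℤ using (+_; _⊖_)
open import Data.Integer.Properties
  using ([+m]-[+n]≡m⊖n; [1+m]⊖[1+n]≡m⊖n; +-assoc; neg-distrib-+; pos-+)
open import Data.Fin as Fin using (Fin; zero; suc; toℕ; fromℕ; inject₁; lower₁; punchOut)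
open import Data.Fin.Properties
  using (pigeonhole; punchOut-injective; toℕ-injective; toℕ<n; toℕ-fromℕ; toℕ-inject₁
        ; toℕ-inject₁-≢; inject₁-lower₁; lower₁-inject₁′)
open import Data.Fin.Induction using (<-weakInduction; >-weakInduction)
open import Data.Product as Product using (Σ; ∃; _×_; _,_; proj₁; proj₂)
open import Data.Sum using (inj₁; inj₂; [_,_]′)
open import Data.List
  using (List; []; _∷_; _++_; length; map; filter; lookup; allFin; cartesianProduct)
open import Data.List.Properties
  using (length-map; length-tabulate; length-++; map-++; filter-++; filter-all; filter-accept
        ; filter-reject; filter-≐)
open import Data.List.Extrema.Nat using (argmax; argmax-sel; f[⊥]≤f[argmax]; f[xs]≤f[argmax])
open import Data.List.Membership.Propositional using (_∈_; _∉_; find; lose)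
open import Data.List.Membership.Propositional.Properties
  using (∈-lookup; ∈-map⁺; ∈-map⁻; ∈-allFin; ∈-filter⁺)
open import Data.List.Relation.Unary.Any using (Any; here; there)
open import Data.List.Relation.Unary.All as All using (All; []; _∷_)
import Data.List.Relation.Unary.All.Properties as All
open import Data.List.Relation.Unary.AllPairs as AllPairs using (AllPairs; []; _∷_)
import Data.List.Relation.Unary.AllPairs.Properties as AllPairs
open import Data.List.Relation.Unary.Unique.Propositional using (Unique)
open import Data.List.Relation.Unary.Unique.Propositional.Properties as Unique using (allFin⁺)
open import Function using (_∘_; id)
open import Function.Bundles using (_⇔_; mk⇔; Equivalence)
import Function.Properties.Equivalence as ⇔
open import Relation.Binary.Definitions using (Symmetric; DecidableEquality; tri<; tri≈; tri>)
open import Relation.Binary.PropositionalEquality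
  using (_≡_; _≢_; refl; sym; trans; cong; cong₂; subst; ≢-sym; module ≡-Reasoning)
open import Relation.Nullary using (yes; no; does; ¬?; contradiction)
open import Relation.Unary using (Pred; Decidable; _≐_)
open import Relation.Unary.Properties using (_∩?_)

module _ {a r} {A : Set a} {R : A → A → Set r} where

  AllPairs-∈ : Symmetric R → ∀ {xs x y} → AllPairs R xs → x ∈ xs → y ∈ xs → x ≢ y → R x y
  AllPairs-∈ sym-R (_   ∷ _)   (here refl) (here refl) x≢y = contradiction refl x≢y
  AllPairs-∈ sym-R (Rx ∷ _)    (here refl) (there y∈)  _   = All.lookup Rx y∈
  AllPairs-∈ sym-R (Rx ∷ _)    (there x∈)  (here refl) _   = sym-R (All.lookup Rx x∈)
  AllPairs-∈ sym-R (_  ∷ Rxs)  (there x∈)  (there y∈)  x≢y = AllPairs-∈ sym-R Rxs x∈ y∈ x≢y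

lookup-injective : ∀ {a} {A : Set a} {xs : List A} → Unique xs →
                   ∀ {i j} → lookup xs i ≡ lookup xs j → i ≡ j
lookup-injective (_   ∷ _) {zero}  {zero}  _  = refl
lookup-injective (x∉ ∷ _) {zero}  {suc j} eq = contradiction eq (All.lookup x∉ (∈-lookup j))
lookup-injective (x∉ ∷ _) {suc i} {zero}  eq = contradiction (sym eq) (All.lookup x∉ (∈-lookup i))
lookup-injective (_  ∷ u) {suc i} {suc j} eq = cong suc (lookup-injective u eq)

length-allFin : ∀ m → length (allFin m) ≡ m
length-allFin m = length-tabulate id

unique∧∉⇒length≤ : ∀ {m} {xs : List (Fin (suc m))} {i} → Unique xs → i ∉ xs → length xs ≤ m
unique∧∉⇒length≤ {m} {xs} {i} u i∉xs = ℕ.≮⇒≥ λ m<len →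
  let (a , b , a<b , fa≡fb) = pigeonhole m<len (λ p → punchOut (i≢lookup p))
  in <-irrefl (cong toℕ (lookup-injective u (punchOut-injective (i≢lookup a) (i≢lookup b) fa≡fb))) a<b
  where
  i≢lookup : ∀ p → i ≢ lookup xs p
  i≢lookup p refl = i∉xs (∈-lookup p)

unique∧length⇒∈ : ∀ {m} {xs : List (Fin m)} → Unique xs → length xs ≡ m → ∀ i → i ∈ xs
unique∧length⇒∈ {suc m} {xs} u len i with i ∈? xs
  where open import Data.List.Membership.DecPropositional (Fin._≟_ {suc m}) using (_∈?_)
... | yes i∈xs = i∈xs
... | no  i∉xs = contradiction (subst (_≤ m) len (unique∧∉⇒length≤ u i∉xs)) ℕ.1+n≰n

count : ∀ {a p} {A : Set a} {P : Pred A p} → Decidable P → List A → ℕ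
count P? xs = length (filter P? xs)

module _ {a p} {A : Set a} {P : Pred A p} (P? : Decidable P) where

  count-++ : ∀ xs ys → count P? (xs ++ ys) ≡ count P? xs + count P? ys
  count-++ xs ys = trans (cong length (filter-++ P? xs ys)) (length-++ (filter P? xs))

  count-all : ∀ {xs} → All P xs → count P? xs ≡ length xs
  count-all Pxs = cong length (filter-all P? Pxs)

  count-map : ∀ {b} {B : Set b} (f : B → A) xs → count P? (map f xs) ≡ count (P? ∘ f) xs
  count-map f []       = refl
  count-map f (x ∷ xs) with P? (f x)
  ... | yes _ = cong suc (count-map f xs)
  ... | no  _ = count-map f xs

  count-≐ : ∀ {q} {Q : Pred A q} (Q? : Decidable Q) → P ≐ Q → ∀ xs → count P? xs ≡ count Q? xs
  count-≐ Q? P≐Q xs = cong length (filter-≐ P? Q? P≐Q xs)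

  filter-∩ : ∀ {q} {Q : Pred A q} (Q? : Decidable Q) xs →
             filter (P? ∩? Q?) xs ≡ filter Q? (filter P? xs)
  filter-∩ Q? []       = refl
  filter-∩ Q? (x ∷ xs) with does (P? x)
  ... | false = filter-∩ Q? xs
  ... | true with does (Q? x)
  ...   | true  = cong (x ∷_) (filter-∩ Q? xs)
  ...   | false = filter-∩ Q? xs

module _ {a} {A : Set a} (_≟_ : DecidableEquality A) where

  ≢? : (x : A) → Decidable (_≢ x)
  ≢? x y = ¬? (y ≟ x)

  count-≢ : ∀ {x xs} → Unique xs → x ∈ xs → suc (count (≢? x) xs) ≡ length xs
  count-≢ {x} {_ ∷ xs} (x∉ ∷ _) (here refl) =
    cong suc (trans (cong length (filter-reject (≢? x) λ x≢x → x≢x refl))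
                    (count-all (≢? x) (All.map ≢-sym x∉)))
  count-≢ {x} {y ∷ xs} (y∉ ∷ u) (there x∈) =
    trans (cong (λ ys → 1 + length ys) (filter-accept (≢? x) (All.lookup y∉ x∈)))
          (cong suc (count-≢ u x∈))

  count-≢₂ : ∀ {x y xs} → x ≢ y → Unique xs → x ∈ xs → y ∈ xs →
             suc (suc (count (≢? x ∩? ≢? y) xs)) ≡ length xs
  count-≢₂ {x} {y} {xs} x≢y u x∈ y∈ = begin
    suc (suc (count (≢? x ∩? ≢? y) xs))   ≡⟨ cong (λ ys → 2 + length ys) (filter-∩ (≢? x) (≢? y) xs) ⟩
    suc (suc (count (≢? y) (filter (≢? x) xs)))
      ≡⟨ cong suc (count-≢ (Unique.filter⁺ (≢? x) u) (∈-filter⁺ (≢? x) y∈ (≢-sym x≢y))) ⟩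
    suc (count (≢? x) xs)                 ≡⟨ count-≢ u x∈ ⟩
    length xs                             ∎
    where open ≡-Reasoning

[1+m]C2≡m+mC2 : ∀ m → suc m C 2 ≡ m + m C 2
[1+m]C2≡m+mC2 m = trans (sym (nCk+nC[k+1]≡[n+1]C[k+1] m 1)) (cong (_+ m C 2) (nC1≡n m))

2*mC2≡m*[m∸1] : ∀ m → 2 * (m C 2) ≡ m * (m ∸ 1)
2*mC2≡m*[m∸1] zero          = refl
2*mC2≡m*[m∸1] (suc zero)    = refl
2*mC2≡m*[m∸1] (suc (suc m)) = begin
  2 * (suc (suc m) C 2)               ≡⟨ cong (2 *_) ([1+m]C2≡m+mC2 (suc m)) ⟩
  2 * (suc m + suc m C 2)             ≡⟨ *-distribˡ-+ 2 (suc m) (suc m C 2) ⟩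
  2 * suc m + 2 * (suc m C 2)         ≡⟨ cong (_+_ (2 * suc m)) (2*mC2≡m*[m∸1] (suc m)) ⟩
  2 * suc m + suc m * m               ≡⟨ expand m ⟩
  suc (suc m) * suc m                 ∎
  where
  open ≡-Reasoning
  expand : ∀ m → 2 * suc m + suc m * m ≡ suc (suc m) * suc m
  expand = solve-∀

module _ {a b p} {A : Set a} {B : Set b} {P : Pred (A × B) p} (P? : Decidable P) where

  count-cartesianProduct : ∀ {c} xs ys → All (λ x → count P? (map (x ,_) ys) ≡ c) xs →
                           count P? (cartesianProduct xs ys) ≡ length xs * c
  count-cartesianProduct []       ys []         = refl
  count-cartesianProduct (x ∷ xs) ys (cx ∷ cxs) =
    trans (count-++ P? (map (x ,_) ys) _) (cong₂ _+_ cx (count-cartesianProduct xs ys cxs))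

module _ {p} {A : Set} {P : Pred (A × A) p} (P? : Decidable P) where

  count-orderedPairs-++ : ∀ xs ys → count P? (orderedPairs (xs ++ ys)) ≡
    count P? (orderedPairs xs) + count P? (cartesianProduct xs ys) + count P? (orderedPairs ys)
  count-orderedPairs-++ []       ys = refl
  count-orderedPairs-++ (x ∷ xs) ys = begin
    count P? (map (x ,_) (xs ++ ys) ++ orderedPairs (xs ++ ys))
      ≡⟨ count-++ P? (map (x ,_) (xs ++ ys)) _ ⟩
    count P? (map (x ,_) (xs ++ ys)) + count P? (orderedPairs (xs ++ ys))
      ≡⟨ cong₂ _+_ (trans (cong (count P?) (map-++ (x ,_) xs ys)) (count-++ P? (map (x ,_) xs) _))
                   (count-orderedPairs-++ xs ys) ⟩
    (x-xs + x-ys) + (xs-xs + xs-ys + ys-ys)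
      ≡⟨ regroup x-xs x-ys xs-xs xs-ys ys-ys ⟩
    (x-xs + xs-xs) + (x-ys + xs-ys) + ys-ys
      ≡⟨ cong₂ (λ s t → s + t + ys-ys) (count-++ P? (map (x ,_) xs) _) (count-++ P? (map (x ,_) ys) _) ⟨
    count P? (map (x ,_) xs ++ orderedPairs xs) + count P? (map (x ,_) ys ++ cartesianProduct xs ys)
      + count P? (orderedPairs ys) ∎
    where
    open ≡-Reasoning
    x-xs  = count P? (map (x ,_) xs)
    x-ys  = count P? (map (x ,_) ys)
    xs-xs = count P? (orderedPairs xs)
    xs-ys = count P? (cartesianProduct xs ys)
    ys-ys = count P? (orderedPairs ys)
    regroup : ∀ a b c d e → (a + b) + (c + d + e) ≡ (a + c) + (b + d) + e
    regroup = solve-∀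

  count-orderedPairs-all : ∀ {xs} → AllPairs (λ x y → P (x , y)) xs →
                           count P? (orderedPairs xs) ≡ length xs C 2
  count-orderedPairs-all {[]}     []         = refl
  count-orderedPairs-all {x ∷ xs} (Px ∷ Pxs) = begin
    count P? (map (x ,_) xs ++ orderedPairs xs)           ≡⟨ count-++ P? (map (x ,_) xs) _ ⟩
    count P? (map (x ,_) xs) + count P? (orderedPairs xs)
      ≡⟨ cong₂ _+_ (trans (count-map P? (x ,_) xs) (count-all _ Px)) (count-orderedPairs-all Pxs) ⟩
    length xs + length xs C 2                             ≡⟨ sym ([1+m]C2≡m+mC2 (length xs)) ⟩
    suc (length xs) C 2                                   ∎
    where open ≡-Reasoning

prev : ∀ {k} → Fin (suc k) → Fin (suc k)
prev {k} zero = fromℕ k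
prev (suc i) = inject₁ i

next : ∀ {k} → Fin (suc k) → Fin (suc k)
next {k} i with k ℕ.≟ toℕ i
... | yes _   = zero
... | no  k≢i = suc (lower₁ i k≢i)

prev-next : ∀ {k} (i : Fin (suc k)) → prev (next i) ≡ i
prev-next {k} i with k ℕ.≟ toℕ i
... | yes k≡i = toℕ-injective (trans (toℕ-fromℕ k) k≡i)
... | no  k≢i = inject₁-lower₁ i k≢i

next-prev : ∀ {k} (i : Fin (suc k)) → next (prev i) ≡ i
next-prev {k} zero with k ℕ.≟ toℕ (fromℕ k)
... | yes _   = refl
... | no  k≢k = contradiction (sym (toℕ-fromℕ k)) k≢k
next-prev {k} (suc i) with k ℕ.≟ toℕ (inject₁ i)
... | yes k≡i = contradiction k≡i (toℕ-inject₁-≢ i)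
... | no  k≢i = cong suc (lower₁-inject₁′ i k≢i)

prev≡⇔≡next : ∀ {k} {i j : Fin (suc k)} → prev i ≡ j ⇔ i ≡ next j
prev≡⇔≡next {i = i} = mk⇔ (λ { refl → sym (next-prev i) }) (λ { refl → prev-next _ })

prev-irreflexive : ∀ {k} (i : Fin (suc (suc k))) → prev i ≢ i
prev-irreflexive zero    ()
prev-irreflexive (suc i) eq = ℕ.1+n≢n (trans (cong toℕ (sym eq)) (toℕ-inject₁ i))

next-irreflexive : ∀ {k} (i : Fin (suc (suc k))) → next i ≢ i
next-irreflexive i next≡i = prev-irreflexive i (trans (sym (cong prev next≡i)) (prev-next i))

prev-closed⇒universal : ∀ {k ℓ} {P : Pred (Fin (suc k)) ℓ} →
  (∀ i → P i → P (prev i)) → ∀ {i} → P i → ∀ j → P j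
prev-closed⇒universal {P = P} closed Pi =
  >-weakInduction P (closed zero P₀) (λ i → closed (suc i))
  where
  P₀ = <-weakInduction (λ i → P i → P zero) id (λ i Pi⇒P₀ → Pi⇒P₀ ∘ closed (suc i)) _ Pi

∣m⊖n∣≡∣m-n∣ : ∀ m n → ℤ.∣ m ⊖ n ∣ ≡ ℕ.∣ m - n ∣
∣m⊖n∣≡∣m-n∣ zero    zero    = refl
∣m⊖n∣≡∣m-n∣ zero    (suc n) = refl
∣m⊖n∣≡∣m-n∣ (suc m) zero    = refl
∣m⊖n∣≡∣m-n∣ (suc m) (suc n) = trans (cong ℤ.∣_∣ ([1+m]⊖[1+n]≡m⊖n m n)) (∣m⊖n∣≡∣m-n∣ m n)

∣[+m-+n]-+o∣≡∣m-[o+n]∣ : ∀ m n o → ℤ.∣ + m ℤ.- + n ℤ.- + o ∣ ≡ ℕ.∣ m - (o + n) ∣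
∣[+m-+n]-+o∣≡∣m-[o+n]∣ m n o = begin
  ℤ.∣ + m ℤ.- + n ℤ.- + o ∣          ≡⟨ cong ℤ.∣_∣ (+-assoc (+ m) (ℤ.- + n) (ℤ.- + o)) ⟩
  ℤ.∣ + m ℤ.+ (ℤ.- + n ℤ.- + o) ∣    ≡⟨ cong (λ z → ℤ.∣ + m ℤ.+ z ∣) (sym (neg-distrib-+ (+ n) (+ o))) ⟩
  ℤ.∣ + m ℤ.- (+ n ℤ.+ + o) ∣        ≡⟨ cong (λ z → ℤ.∣ + m ℤ.- z ∣) (sym (pos-+ n o)) ⟩
  ℤ.∣ + m ℤ.- + (n + o) ∣            ≡⟨ cong ℤ.∣_∣ ([+m]-[+n]≡m⊖n m (n + o)) ⟩
  ℤ.∣ m ⊖ (n + o) ∣                  ≡⟨ ∣m⊖n∣≡∣m-n∣ m (n + o) ⟩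
  ℕ.∣ m - n + o ∣                    ≡⟨ cong (ℕ.∣ m -_∣) (ℕ.+-comm n o) ⟩
  ℕ.∣ m - (o + n) ∣                  ∎
  where open ≡-Reasoning

∣∧<⇒≡0 : ∀ {d m} → d ∣ m → m < d → m ≡ 0
∣∧<⇒≡0 {m = zero}  _   _   = refl
∣∧<⇒≡0 {m = suc m} d∣m m<d = contradiction d∣m (>⇒∤ m<d)

∣∣m-n∣⇔≡ : ∀ {d m n} → m < d → n < d → d ∣ ℕ.∣ m - n ∣ ⇔ m ≡ n
∣∣m-n∣⇔≡ {d} {m} {n} m<d n<d = mk⇔
  (λ d∣ → ∣m-n∣≡0⇒m≡n (∣∧<⇒≡0 d∣ (≤-<-trans (∣m-n∣≤m⊔n m n) (⊔-lub m<d n<d))))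
  (λ m≡n → subst (d ∣_) (sym (m≡n⇒∣m-n∣≡0 m≡n)) (d ∣0))

congMod-0⇔≡ : ∀ {v} (i j : Fin v) → CongMod v (+ toℕ i ℤ.- + toℕ j) (+ 0) ⇔ i ≡ j
congMod-0⇔≡ {v} i j = mk⇔
  (toℕ-injective ∘ Equivalence.to ∣i-j∣⇔ ∘ subst (v ∣_) (∣[+m-+n]-+o∣≡∣m-[o+n]∣ (toℕ i) (toℕ j) 0))
  (subst (v ∣_) (sym (∣[+m-+n]-+o∣≡∣m-[o+n]∣ (toℕ i) (toℕ j) 0)) ∘ Equivalence.from ∣i-j∣⇔ ∘ cong toℕ)
  where ∣i-j∣⇔ = ∣∣m-n∣⇔≡ (toℕ<n i) (toℕ<n j)

congMod-1⇔prev≡ : ∀ {k} (i j : Fin (suc k)) → CongMod (suc k) (+ toℕ i ℤ.- + toℕ j) (+ 1) ⇔ prev i ≡ j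
congMod-1⇔prev≡ {k} i j = mk⇔
  (to i ∘ subst (suc k ∣_) (∣[+m-+n]-+o∣≡∣m-[o+n]∣ (toℕ i) (toℕ j) 1))
  (subst (suc k ∣_) (sym (∣[+m-+n]-+o∣≡∣m-[o+n]∣ (toℕ i) (toℕ j) 1)) ∘ from i)
  where
  to : ∀ i → suc k ∣ ℕ.∣ toℕ i - suc (toℕ j) ∣ → prev i ≡ j
  to zero    k∣ = toℕ-injective (trans (toℕ-fromℕ k) (suc-injective (≤-antisym (∣⇒≤ k∣) (toℕ<n j))))
  to (suc i) k∣ = toℕ-injective (trans (toℕ-inject₁ i)
    (Equivalence.to (∣∣m-n∣⇔≡ (ℕ.m<n⇒m<1+n (toℕ<n i)) (toℕ<n j)) k∣))
  from : ∀ i → prev i ≡ j → suc k ∣ ℕ.∣ toℕ i - suc (toℕ j) ∣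
  from zero    refl = subst (λ m → suc k ∣ suc m) (sym (toℕ-fromℕ k)) ∣-refl
  from (suc i) refl = Equivalence.from (∣∣m-n∣⇔≡ (ℕ.m<n⇒m<1+n (toℕ<n i)) (toℕ<n (inject₁ i)))
    (sym (toℕ-inject₁ i))

notDiff01⇔ : ∀ {k} (j ℓ : Fin (suc k)) → NotDiff01 j ℓ ⇔ (ℓ ≢ j × prev ℓ ≢ j)
notDiff01⇔ j ℓ = mk⇔
  (Product.map (_∘ Equivalence.from (congMod-0⇔≡ ℓ j)) (_∘ Equivalence.from (congMod-1⇔prev≡ ℓ j)))
  (Product.map (_∘ Equivalence.to (congMod-0⇔≡ ℓ j)) (_∘ Equivalence.to (congMod-1⇔prev≡ ℓ j)))

module _ {n v : ℕ} where

  ΓAdj-sym : ∀ {x y} → ΓAdj n v x y → ΓAdj n v y x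
  ΓAdj-sym (inj₁ (i≡k , j≢ℓ)) = inj₁ (sym i≡k , ≢-sym j≢ℓ)
  ΓAdj-sym (inj₂ (inj₁ i<k))   = inj₂ (inj₂ i<k)
  ΓAdj-sym (inj₂ (inj₂ k<i))   = inj₂ (inj₁ k<i)

  ΓAdj⇒col≢ : ∀ {x y} → ΓAdj n v x y → proj₂ x ≢ proj₂ y
  ΓAdj⇒col≢ (inj₁ (_ , j≢ℓ))                  = j≢ℓ
  ΓAdj⇒col≢ {_ , j} (inj₂ (inj₁ (_ , ≢0 , _))) refl = ≢0 (Equivalence.from (congMod-0⇔≡ j j) refl)
  ΓAdj⇒col≢ {_ , j} (inj₂ (inj₂ (_ , ≢0 , _))) refl = ≢0 (Equivalence.from (congMod-0⇔≡ j j) refl)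

module _ {n k : ℕ} {r r' : Fin n} {j ℓ : Fin (suc k)} where

  ΓAdj-<⇔ : toℕ r < toℕ r' → ΓAdj n (suc k) (r , j) (r' , ℓ) ⇔ (ℓ ≢ j × ℓ ≢ next j)
  ΓAdj-<⇔ r<r' = mk⇔
    (λ { (inj₁ (r≡r' , _))          → contradiction (cong toℕ r≡r') (ℕ.<⇒≢ r<r')
       ; (inj₂ (inj₁ (_ , nd)))      → from-notDiff01 nd
       ; (inj₂ (inj₂ (r'<r , _)))    → contradiction r'<r (<-asym r<r') })
    (λ nd → inj₂ (inj₁ (r<r' , to-notDiff01 nd)))
    where
    from-notDiff01 : NotDiff01 j ℓ → ℓ ≢ j × ℓ ≢ next j
    from-notDiff01 = Product.map₂ (_∘ Equivalence.from prev≡⇔≡next) ∘ Equivalence.to (notDiff01⇔ j ℓ)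
    to-notDiff01 : ℓ ≢ j × ℓ ≢ next j → NotDiff01 j ℓ
    to-notDiff01 = Equivalence.from (notDiff01⇔ j ℓ) ∘ Product.map₂ (_∘ Equivalence.to prev≡⇔≡next)

  ΓAdj->⇔ : toℕ r' < toℕ r → ΓAdj n (suc k) (r , j) (r' , ℓ) ⇔ (ℓ ≢ j × ℓ ≢ prev j)
  ΓAdj->⇔ r'<r = mk⇔
    (λ { (inj₁ (r≡r' , _))          → contradiction (cong toℕ (sym r≡r')) (ℕ.<⇒≢ r'<r)
       ; (inj₂ (inj₁ (r<r' , _)))    → contradiction r'<r (<-asym r<r')
       ; (inj₂ (inj₂ (_ , nd)))      → from-notDiff01 nd })
    (λ nd → inj₂ (inj₂ (r'<r , to-notDiff01 nd)))
    where
    from-notDiff01 : NotDiff01 ℓ j → ℓ ≢ j × ℓ ≢ prev j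
    from-notDiff01 = Product.map ≢-sym ≢-sym ∘ Equivalence.to (notDiff01⇔ ℓ j)
    to-notDiff01 : ℓ ≢ j × ℓ ≢ prev j → NotDiff01 ℓ j
    to-notDiff01 = Equivalence.from (notDiff01⇔ ℓ j) ∘ Product.map ≢-sym ≢-sym

module _ {n k : ℕ} where
  open Γ n (suc k)

  row : Fin n → List (Vertex n (suc k))
  row i = map (i ,_) (allFin (suc k))

  clique⇒row : ∀ {K} → IsClique (suc k) K → Σ (Fin n) λ m → SameSet K (row m)
  clique⇒row {c ∷ cs} (_ , len , adj) = m , λ x → mk⇔ (K⊆row-m x) row-m⊆K
    where
    K = c ∷ cs

    adjacent : ∀ {x y} → x ∈ K → y ∈ K → x ≢ y → ΓAdj n (suc k) x y
    adjacent = AllPairs-∈ ΓAdj-sym adj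

    columns-unique : Unique (map proj₂ K)
    columns-unique = AllPairs.map⁺ (AllPairs.map ΓAdj⇒col≢ adj)

    columns-length : length (map proj₂ K) ≡ suc k
    columns-length = trans (length-map proj₂ K) len

    column-covered : ∀ j → ∃ λ r → (r , j) ∈ K
    column-covered j
      with (r , _) , rj∈K , refl ← ∈-map⁻ proj₂ (unique∧length⇒∈ columns-unique columns-length j)
      = r , rj∈K

    top : Vertex n (suc k)
    top = argmax (toℕ ∘ proj₁) c cs

    m : Fin n
    m = proj₁ top

    top∈K : top ∈ K
    top∈K = [ here , there ]′ (argmax-sel (toℕ ∘ proj₁) c cs)

    below-m : ∀ {x} → x ∈ K → toℕ (proj₁ x) ≤ toℕ m
    below-m (here refl) = f[⊥]≤f[argmax] {f = toℕ ∘ proj₁} c cs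
    below-m (there x∈)  = All.lookup (f[xs]≤f[argmax] {f = toℕ ∘ proj₁} c cs) x∈

    prev-closed : ∀ j → (m , j) ∈ K → (m , prev j) ∈ K
    prev-closed j mj∈K with r , r∈K ← column-covered (prev j) | toℕ r ℕ.<? toℕ m
    ... | yes r<m = contradiction (sym (next-prev j)) (proj₂ (Equivalence.to (ΓAdj-<⇔ r<m)
                      (adjacent r∈K mj∈K λ eq → <-irrefl (cong (toℕ ∘ proj₁) eq) r<m)))
    ... | no  r≮m = subst (λ r → (r , prev j) ∈ K) (toℕ-injective (≤-antisym (below-m r∈K) (ℕ.≮⇒≥ r≮m))) r∈K

    row-m-in-K : ∀ j → (m , j) ∈ K
    row-m-in-K = prev-closed⇒universal prev-closed top∈K

    K⊆row-m : ∀ x → x ∈ K → x ∈ row m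
    K⊆row-m (r , j) x∈ with r Fin.≟ m
    ... | yes refl = ∈-map⁺ (r ,_) (∈-allFin j)
    ... | no  r≢m  = contradiction refl (ΓAdj⇒col≢ (adjacent x∈ (row-m-in-K j) (r≢m ∘ cong proj₁)))

    row-m⊆K : ∀ {x} → x ∈ row m → x ∈ K
    row-m⊆K x∈ with j , _ , refl ← ∈-map⁻ (m ,_) x∈ = row-m-in-K j

  rows : List (List (Vertex n (suc k)))
  rows = map row (allFin n)

  row∈rows : ∀ i → row i ∈ rows
  row∈rows i = ∈-map⁺ row (∈-allFin i)

  ∈row : ∀ {i} j → (i , j) ∈ row i
  ∈row {i} j = ∈-map⁺ (i ,_) (∈-allFin j)

  row-isClique : ∀ i → IsClique (suc k) (row i)
  row-isClique i =
      AllPairs.map⁺ (AllPairs.map (λ j≢ℓ → j≢ℓ ∘ cong proj₂) (allFin⁺ (suc k)))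
    , trans (length-map (i ,_) (allFin (suc k))) (length-allFin (suc k))
    , AllPairs.map⁺ (AllPairs.map (λ j≢ℓ → inj₁ (refl , j≢ℓ)) (allFin⁺ (suc k)))

  rows-disjoint : ∀ {i i'} → i ≢ i' → Disjoint (row i) (row i')
  rows-disjoint i≢i' x x∈ x∈'
    with _ , _ , refl ← ∈-map⁻ _ x∈ | _ , _ , x≡ ← ∈-map⁻ _ x∈' = i≢i' (cong proj₁ x≡)

  rows-isDecomposition : IsDecomposition n (suc k) rows
  rows-isDecomposition =
      trans (length-map row (allFin n)) (length-allFin n)
    , All.map⁺ (All.universal row-isClique (allFin n))
    , AllPairs.map⁺ (AllPairs.map rows-disjoint (allFin⁺ n))
    , λ (i , j) → lose (row∈rows i) (∈row j)

  clique-in-rows : ∀ K → IsClique (suc k) K → Any (SameSet K) rows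
  clique-in-rows K K-clique = let (m , K≈row-m) = clique⇒row K-clique in lose (row∈rows m) K≈row-m

  rows-unique : ∀ D → IsDecomposition n (suc k) D → SameFamily rows D
  rows-unique D (_ , cliques , _ , covers) =
      All.map⁺ (All.universal row-in-D (allFin n))
    , All.map (clique-in-rows _) cliques
    where
    row-in-D : ∀ i → Any (SameSet (row i)) D
    row-in-D i with find (covers (i , zero))
    ... | K , K∈D , i0∈K with clique⇒row (All.lookup cliques K∈D)
    ... | m , K≈row-m with ∈-map⁻ (m ,_) (Equivalence.to (K≈row-m (i , zero)) i0∈K)
    ... | _ , _ , refl = lose K∈D (λ x → ⇔.sym (K≈row-m x))

  Γ-stronglyCP : StronglyCP n (suc k)
  Γ-stronglyCP = rows , rows-isDecomposition , rows-unique , clique-in-rows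

module _ {n w : ℕ} where
  private
    v : ℕ
    v = 2 + w

  adjacent? : Decidable (λ (p : Vertex n v × Vertex n v) → ΓAdj n v (proj₁ p) (proj₂ p))
  adjacent? p = ΓAdj? n v (proj₁ p) (proj₂ p)

  count-allFin-≢₂ : ∀ {i j : Fin v} → i ≢ j → count (≢? Fin._≟_ i ∩? ≢? Fin._≟_ j) (allFin v) ≡ w
  count-allFin-≢₂ {i} {j} i≢j = suc-injective (suc-injective
    (trans (count-≢₂ Fin._≟_ i≢j (allFin⁺ v) (∈-allFin i) (∈-allFin j)) (length-allFin v)))

  count-adjacent-all-but-two : ∀ {r r' j a b} → (∀ {ℓ} → ΓAdj n v (r , j) (r' , ℓ) ⇔ (ℓ ≢ a × ℓ ≢ b)) →
                               a ≢ b → count (adjacent? ∘ ((r , j) ,_)) (row r') ≡ w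
  count-adjacent-all-but-two {r} {r'} {j} {a} {b} adj⇔ a≢b = begin
    count (adjacent? ∘ ((r , j) ,_)) (map (r' ,_) (allFin v))
      ≡⟨ count-map (adjacent? ∘ ((r , j) ,_)) (r' ,_) (allFin v) ⟩
    count (adjacent? ∘ ((r , j) ,_) ∘ (r' ,_)) (allFin v)
      ≡⟨ count-≐ (adjacent? ∘ ((r , j) ,_) ∘ (r' ,_)) (≢? Fin._≟_ a ∩? ≢? Fin._≟_ b)
                 (Equivalence.to adj⇔ , Equivalence.from adj⇔) (allFin v) ⟩
    count (≢? Fin._≟_ a ∩? ≢? Fin._≟_ b) (allFin v)
      ≡⟨ count-allFin-≢₂ a≢b ⟩
    w ∎
    where open ≡-Reasoning

  count-adjacent-row : ∀ {r r'} → r ≢ r' → ∀ j → count (adjacent? ∘ ((r , j) ,_)) (row r') ≡ w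
  count-adjacent-row {r} {r'} r≢r' j with ℕ.<-cmp (toℕ r) (toℕ r')
  ... | tri< r<r' _ _ = count-adjacent-all-but-two (ΓAdj-<⇔ r<r') (≢-sym (next-irreflexive j))
  ... | tri≈ _ r≡r' _ = contradiction (toℕ-injective r≡r') r≢r'
  ... | tri> _ _ r'<r = count-adjacent-all-but-two (ΓAdj->⇔ r'<r) (≢-sym (prev-irreflexive j))

  count-adjacent-rows : ∀ {r rs} → All (r ≢_) rs → ∀ j →
    count (adjacent? ∘ ((r , j) ,_)) (cartesianProduct rs (allFin v)) ≡ length rs * w
  count-adjacent-rows {r} {rs} r∉rs j =
    count-cartesianProduct (adjacent? ∘ ((r , j) ,_)) rs (allFin v) (All.map (λ r≢r' → count-adjacent-row r≢r' j) r∉rs)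

  count-edges : ∀ {rs} → Unique rs → count adjacent? (orderedPairs (cartesianProduct rs (allFin v)))
                ≡ length rs * (v C 2) + (length rs C 2) * (v * w)
  count-edges {[]}     []                     = refl
  count-edges {r ∷ rs} (r∉rs ∷ rs-unique) = begin
    count adjacent? (orderedPairs (row r ++ rest))
      ≡⟨ count-orderedPairs-++ adjacent? (row r) rest ⟩
    count adjacent? (orderedPairs (row r)) + count adjacent? (cartesianProduct (row r) rest)
      + count adjacent? (orderedPairs rest)
      ≡⟨ cong₂ _+_ (cong₂ _+_ inside-row across-rows) (count-edges rs-unique) ⟩
    v C 2 + v * (length rs * w) + (length rs * (v C 2) + (length rs C 2) * (v * w))
      ≡⟨ regroup (v C 2) (length rs C 2) v (length rs) w ⟩
    suc (length rs) * (v C 2) + (length rs + length rs C 2) * (v * w)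
      ≡⟨ cong (λ t → suc (length rs) * (v C 2) + t * (v * w)) ([1+m]C2≡m+mC2 (length rs)) ⟨
    suc (length rs) * (v C 2) + (suc (length rs) C 2) * (v * w) ∎
    where
    open ≡-Reasoning
    rest = cartesianProduct rs (allFin v)
    regroup : ∀ t s v k w → t + v * (k * w) + (k * t + s * (v * w)) ≡ suc k * t + (k + s) * (v * w)
    regroup = solve-∀
    inside-row : count adjacent? (orderedPairs (row r)) ≡ v C 2
    inside-row = let (_ , length≡v , adjacent) = row-isClique {k = suc w} r
                 in trans (count-orderedPairs-all adjacent? adjacent) (cong (_C 2) length≡v)
    across-rows : count adjacent? (cartesianProduct (row r) rest) ≡ v * (length rs * w)
    across-rows = trans
      (count-cartesianProduct adjacent? {c = length rs * w} (row r) rest (All.map⁺ (All.universal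
        (λ j → trans (count-map adjacent? ((r , j) ,_) rest) (count-adjacent-rows r∉rs j)) (allFin v))))
      (cong (_* (length rs * w)) (proj₁ (proj₂ (row-isClique {k = suc w} r))))

  2*ΓEdgeCount : 2 * ΓEdgeCount n v ≡ n * (v * (v ∸ 1)) + n * v * (n ∸ 1) * w
  2*ΓEdgeCount = begin
    2 * count adjacent? (orderedPairs (cartesianProduct (allFin n) (allFin v)))
      ≡⟨ cong (2 *_) (count-edges (allFin⁺ n)) ⟩
    2 * (length (allFin n) * (v C 2) + (length (allFin n) C 2) * (v * w))
      ≡⟨ cong (λ m → 2 * (m * (v C 2) + (m C 2) * (v * w))) (length-allFin n) ⟩
    2 * (n * (v C 2) + (n C 2) * (v * w))
      ≡⟨ distribute n (v C 2) (n C 2) (v * w) ⟩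
    n * (2 * (v C 2)) + 2 * (n C 2) * (v * w)
      ≡⟨ cong₂ (λ a b → n * a + b * (v * w)) (2*mC2≡m*[m∸1] v) (2*mC2≡m*[m∸1] n) ⟩
    n * (v * (v ∸ 1)) + n * (n ∸ 1) * (v * w)
      ≡⟨ cong (_+_ (n * (v * (v ∸ 1)))) (reorder n (n ∸ 1) v w) ⟩
    n * (v * (v ∸ 1)) + n * v * (n ∸ 1) * w ∎
    where
    open ≡-Reasoning
    distribute : ∀ n t s x → 2 * (n * t + s * x) ≡ n * (2 * t) + 2 * s * x
    distribute = solve-∀
    reorder : ∀ a b c d → a * b * (c * d) ≡ a * c * b * d
    reorder = solve-∀

theorem2p3 : (n v : ℕ) → 2 ≤ n → 2 ≤ v →
    Γ.StronglyCP n v n v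
    × 2 * ΓEdgeCount n v ≡ n * (v * (v ∸ 1)) + n * v * (n ∸ 1) * (v ∸ 2)
theorem2p3 n (suc (suc w)) _ (s≤s (s≤s _)) = Γ-stronglyCP , 2*ΓEdgeCount {n} {w}
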